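{- For any stoup $S$ and any contexts $\Gamma, \Delta$, there is a derivation $\llbracket S \mid \Gamma, \Delta \rrbracket \Rightarrow \llbracket S \mid \Gamma \rrbracket \otimes \llbracket - \mid \Delta \rrbracket$ in the skew monoidal categorical calculus.
   Context: Fix a set $\mathrm{Var}$ of atoms. Formulae are generated by: every atom $X \in \mathrm{Var}$ is a formula; $\mathsf{I}$ is a formula; if $A, B$ are formulae then so is $A \otimes B$. A context $\Gamma$ is a finite list of formulae; a stoup $S$ is either empty (written $-$) or a single formula. The skew monoidal categorical calculus derives judgements $A \Rightarrow C$ by the rules: $\mathrm{id}_A : A \Rightarrow A$; from $f : A \Rightarrow B$ and $g : B \Rightarrow C$ infer $g \circ f : A \Rightarrow C$; from $f : A \Rightarrow C$ and $g : B \Rightarrow D$ infer $f \otimes g : A \otimes B \Rightarrow C \otimes D$; axioms $\lambda_A : \mathsf{I} \otimes A \Rightarrow A$, $\rho_A : A \Rightarrow A \otimes \mathsf{I}$, $\alpha_{A,B,C} : (A \otimes B) \otimes C \Rightarrow A \otimes (B \otimes C)$. Interpretation of antecedents: $\llbracket - \rrbracket = \mathsf{I}$ and $\llbracket A \rrbracket = A$ for a stoup; $C \triangleleft () = C$ and $C \triangleleft (A, \Gamma) = (C \otimes A) \triangleleft \Gamma$; and $\llbracket S \mid \Gamma \rrbracket = \llbracket S \rrbracket \triangleleft \Gamma$. So for instance $\llbracket - \mid A_1,\dots,A_n \rrbracket = (\cdots((\mathsf{I} \otimes A_1) \otimes A_2)\cdots) \otimes A_n$. -}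

module Defs where

open import Data.List using (List; []; _∷_; _++_)
open import Data.Maybe using (Maybe; nothing; just)

data Fma (At : Set) : Set where
  ` : At → Fma At
  I : Fma At
  _⊗_ : Fma At → Fma At → Fma At

infixl 25 _⊗_

Cxt : Set → Set
Cxt At = List (Fma At)

Stp : Set → Set
Stp At = Maybe (Fma At)

infix 15 _⇒_
data _⇒_ {At : Set} : Fma At → Fma At → Set where
  id   : {A : Fma At} → A ⇒ A
  _∘_  : {A B C : Fma At} → B ⇒ C → A ⇒ B → A ⇒ C
  _⊗'_ : {A B C D : Fma At} → A ⇒ C → B ⇒ D → A ⊗ B ⇒ C ⊗ D
  l    : {A : Fma At} → I ⊗ A ⇒ A
  ρ    : {A : Fma At} → A ⇒ A ⊗ I
  α    : {A B C : Fma At} → (A ⊗ B) ⊗ C ⇒ A ⊗ (B ⊗ C)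

t : {At : Set} → Stp At → Fma At
t nothing  = I
t (just A) = A

_◁_ : {At : Set} → Fma At → Cxt At → Fma At
C ◁ []      = C
C ◁ (A ∷ Γ) = (C ⊗ A) ◁ Γ

⟦_∣_⟧ : {At : Set} → Stp At → Cxt At → Fma At
⟦ S ∣ Γ ⟧ = t S ◁ Γ

module Submission where

open import Defs
open import Data.List using (List; []; _∷_; _++_)
open import Data.Maybe using (Maybe; nothing)

-- Split C ◁ (Γ ++ Δ) after Γ by ρ, then use α to absorb each formula of Δ
-- into the right factor, which starts out as I.

◁-distribʳ-⊗ : {At : Set} {C C' D : Fma At} (Δ : Cxt At) →
  C ⇒ C' ⊗ D → C ◁ Δ ⇒ C' ⊗ (D ◁ Δ)
◁-distribʳ-⊗ []      f = f
◁-distribʳ-⊗ (A ∷ Δ) f = ◁-distribʳ-⊗ Δ (α ∘ (f ⊗' id))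

◁-++-split : {At : Set} (C : Fma At) (Γ Δ : Cxt At) →
  C ◁ (Γ ++ Δ) ⇒ (C ◁ Γ) ⊗ (I ◁ Δ)
◁-++-split C []      Δ = ◁-distribʳ-⊗ Δ ρ
◁-++-split C (A ∷ Γ) Δ = ◁-++-split (C ⊗ A) Γ Δ

lemma3p6 : {At : Set} (S : Stp At) (Γ Δ : Cxt At) →
    ⟦ S ∣ Γ ++ Δ ⟧ ⇒ ⟦ S ∣ Γ ⟧ ⊗ ⟦ nothing ∣ Δ ⟧
lemma3p6 S = ◁-++-split (t S)
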